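{- Let $(\bigcup_{i=1}^n(X_i,\precsim_i),\mathcal{P}=\bigcup_{i\neq j}\mathcal{P}_{ij})$ and $(\bigcup_{i=1}^n(X_i,\precsim_i),\mathcal{P}'=\bigcup_{i\neq j}\mathcal{P}'_{ij})$ be two distributed systems with the same processes, both with line communication. Assume that the causal ordering of messages is always satisfied and that there are no cycles (i.e. the causal precedence is a strict partial order). Then the corresponding causal precedences coincide, $\rightarrow_1=\rightarrow_2$, if and only if $\mathcal{P}_{ij}=\mathcal{P}'_{ij}$ for every $i\neq j$.
   Context: A communication from $A$ to $B$ is a finite relation $\mathcal{P}\subseteq A\times B$ such that whenever $(a,b)\in\mathcal{P}$: $(a',b)\in\mathcal{P}$ implies $a'=a$, and $(a,b')\in\mathcal{P}$ implies $b'=b$. A distributed system $(\bigcup_{i=1}^n(X_i,\precsim_i),\mathcal{P})$ consists of pairwise disjoint totally ordered sets (processes) $(X_i,\precsim_i)$ and communications $\mathcal{P}_{ij}$ from $X_i$ to $X_j$ for $i\neq j$ (possibly empty). Its causal precedence $\rightarrow$ is the transitive closure of the union of the strict orders $\prec_i$ and all $\mathcal{P}_{ij}$. It has line communication if $\mathcal{P}_{ij}=\emptyset$ whenever $j\neq i+1$. The causal ordering of messages: if $a,a'\in X_i$, $b,b'\in X_j$, $a\mathcal{P}_{ij}b$, $a'\mathcal{P}_{ij}b'$ and $a\prec_i a'$, then $b\prec_j b'$. -}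

module Defs where

open import Level using (Level; _⊔_)
open import Data.Nat using (ℕ; suc)
open import Data.Fin using (Fin; toℕ)
open import Data.Product using (Σ; _×_; _,_)
open import Data.List using (List)
open import Data.List.Membership.Propositional using (_∈_)
open import Relation.Binary.Core using (Rel)
open import Relation.Binary.Structures using (IsTotalOrder)
open import Relation.Binary.PropositionalEquality using (_≡_; _≢_)
open import Relation.Binary.Construct.Closure.Transitive using (TransClosure)
open import Relation.Nullary using (¬_)
open import Function.Bundles using (_⇔_)

-- The processes: n pairwise disjoint totally ordered sets (X i , ≾ i).
-- Disjointness is modelled by taking the set of all events to be the
-- disjoint union  Σ (Fin n) X.
record Processes (n : ℕ) (a ℓ : Level) : Set (Level.suc (a ⊔ ℓ)) where
  field
    X       : Fin n → Set a
    ≾       : (i : Fin n) → Rel (X i) ℓ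
    isTotal : ∀ i → IsTotalOrder {A = X i} _≡_ (≾ i)


  ≺ : (i : Fin n) → Rel (X i) (a ⊔ ℓ)
  ≺ i x y = ≾ i x y × x ≢ y

  Event : Set a
  Event = Σ (Fin n) X

module _ {n : ℕ} {a ℓ : Level} (Pr : Processes n a ℓ) where
  open Processes Pr

  -- Communications: for every ordered pair (i , j) a finite relation
  -- P i j ⊆ X i × X j, given as a finite list of pairs (only i ≢ j is used).
  Comms : Set a
  Comms = (i j : Fin n) → List (X i × X j)

  IsCommunication : ∀ {i j} → List (X i × X j) → Set a
  IsCommunication L =
    (∀ {x x' y} → (x , y) ∈ L → (x' , y) ∈ L → x' ≡ x) ×
    (∀ {x y y'} → (x , y) ∈ L → (x , y') ∈ L → y' ≡ y)

  IsDistributedSystem : Comms → Set a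
  IsDistributedSystem P = ∀ i j → i ≢ j → IsCommunication (P i j)

  LineCommunication : Comms → Set a
  LineCommunication P =
    ∀ i j → i ≢ j → toℕ j ≢ suc (toℕ i) → ∀ x y → ¬ ((x , y) ∈ P i j)

  CausalOrdering : Comms → Set (a ⊔ ℓ)
  CausalOrdering P =
    ∀ i j → i ≢ j → ∀ x x' y y' →
      (x , y) ∈ P i j → (x' , y') ∈ P i j → ≺ i x x' → ≺ j y y'

  data Step (P : Comms) : Rel Event (a ⊔ ℓ) where
    local : ∀ {i x y} → ≺ i x y → Step P (i , x) (i , y)
    msg   : ∀ {i j x y} → i ≢ j → (x , y) ∈ P i j → Step P (i , x) (j , y)

  CausalPrecedence : Comms → Rel Event (a ⊔ ℓ)
  CausalPrecedence P = TransClosure (Step P)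

  -- No cycles: causal precedence is irreflexive (hence a strict partial order,
  -- being transitive by construction).
  Acyclic : Comms → Set (a ⊔ ℓ)
  Acyclic P = ∀ e → ¬ CausalPrecedence P e e

  SameRel : Rel Event (a ⊔ ℓ) → Rel Event (a ⊔ ℓ) → Set (a ⊔ ℓ)
  SameRel R S = ∀ e e' → R e e' ⇔ S e e'

  SameComms : Comms → Comms → Set a
  SameComms P P' =
    ∀ i j → i ≢ j → ∀ x y → ((x , y) ∈ P i j) ⇔ ((x , y) ∈ P' i j)

{-# OPTIONS --safe #-}
-- Along a causal chain the process index never decreases, and with line communication
-- each message raises it by exactly one. Hence a chain inside one process is a chain of ≺, and a
-- chain from process i to process i+1 consists of local steps around exactly one message. If
-- →₁ = →₂ and x P y, then x →₂ y gives a P'-message x₁ ↦ y₁ with x ≼ x₁ and y₁ ≼ y, and x₁ →₁ y₁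
-- in turn gives a P-message x₂ ↦ y₂ with x₁ ≼ x₂ and y₂ ≼ y₁. Causal ordering of P forbids
-- x ≺ x₂ (it would force y ≺ y₂ ≼ y), so x₂ = x, y₂ = y, and antisymmetry collapses the chain.
module Submission where

open import Defs
open import Level using (Level; _⊔_)
open import Data.Nat using (ℕ; suc; _≤_; _≟_)
open import Data.Nat.Properties using (≤-refl; ≤-trans; ≤-reflexive; n≤1+n; 1+n≰n; n<1+n; <⇒≢)
open import Data.Fin using (Fin; toℕ)
open import Data.Fin.Properties using (toℕ-injective)
open import Data.Product using (_×_; _,_; proj₁; proj₂; ∃₂)
open import Data.List.Membership.Propositional using (_∈_)
open import Function.Base using (_∘_)
open import Function.Bundles using (_⇔_; mk⇔; Equivalence)
open import Relation.Nullary using (contradiction)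
open import Relation.Nullary.Decidable using (decidable-stable)
open import Relation.Binary.Core using (Rel; _⇒_)
open import Relation.Binary.Structures using (IsTotalOrder; IsPartialOrder; IsStrictPartialOrder)
open import Relation.Binary.PropositionalEquality using (_≡_; _≢_; refl; sym; trans; subst₂)
open import Relation.Binary.Construct.Closure.Transitive using ([_]; _∷_)
open import Relation.Binary.Construct.Closure.Reflexive using (ReflClosure; [_])
  renaming (refl to ε)
import Relation.Binary.Construct.Closure.Reflexive.Properties as ReflClosure
import Relation.Binary.Construct.NonStrictToStrict as NonStrictToStrict

module _ {n : ℕ} {a ℓ : Level} (Pr : Processes n a ℓ) where
  open Processes Pr

  ≺-isStrictPartialOrder : ∀ i → IsStrictPartialOrder _≡_ (≺ i)
  ≺-isStrictPartialOrder i =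
    NonStrictToStrict.<-isStrictPartialOrder _≡_ (≾ i) (IsTotalOrder.isPartialOrder (isTotal i))

  module ≺ (i : Fin n) = IsStrictPartialOrder (≺-isStrictPartialOrder i)

  ≼ : (i : Fin n) → Rel (X i) (a ⊔ ℓ)
  ≼ i = ReflClosure (≺ i)

  module ≼ (i : Fin n) = IsPartialOrder (ReflClosure.isPartialOrder (≺-isStrictPartialOrder i))

  level : Event → ℕ
  level = toℕ ∘ proj₁

  module _ (P : Comms Pr) (line : LineCommunication Pr P) where

    message-level : ∀ {i j x y} → i ≢ j → (x , y) ∈ P i j → toℕ j ≡ suc (toℕ i)
    message-level {i} {j} {x} {y} i≢j m =
      decidable-stable (toℕ j ≟ suc (toℕ i)) (λ j≢1+i → line i j i≢j j≢1+i x y m)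

    step-level-mono : ∀ {e e'} → Step Pr P e e' → level e ≤ level e'
    step-level-mono (local _)   = ≤-refl
    step-level-mono (msg i≢j m) = ≤-trans (n≤1+n _) (≤-reflexive (sym (message-level i≢j m)))

    precedence-level-mono : ∀ {e e'} → CausalPrecedence Pr P e e' → level e ≤ level e'
    precedence-level-mono [ s ]   = step-level-mono s
    precedence-level-mono (s ∷ r) = ≤-trans (step-level-mono s) (precedence-level-mono r)

    precedence-within-process : ∀ {i x y} → CausalPrecedence Pr P (i , x) (i , y) → ≺ i x y
    precedence-within-process [ local x≺y ]   = x≺y
    precedence-within-process [ msg i≢i _ ]   = contradiction refl i≢i
    precedence-within-process (local x≺z ∷ r) = ≺.trans _ x≺z (precedence-within-process r)
    precedence-within-process (msg i≢j m ∷ r) = contradiction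
      (≤-trans (≤-reflexive (sym (message-level i≢j m))) (precedence-level-mono r)) 1+n≰n

    precedence-to-next-process :
      ∀ {i j x y} → CausalPrecedence Pr P (i , x) (j , y) → toℕ j ≡ suc (toℕ i) →
      ∃₂ λ x₁ y₁ → ≼ i x x₁ × (x₁ , y₁) ∈ P i j × ≼ j y₁ y
    precedence-to-next-process [ local _ ] j≡1+i = contradiction j≡1+i (<⇒≢ (n<1+n _))
    precedence-to-next-process [ msg _ m ] _     = _ , _ , ε , m , ε
    precedence-to-next-process (local x≺z ∷ r) j≡1+i
      with precedence-to-next-process r j≡1+i
    ... | x₁ , y₁ , z≼x₁ , m , y₁≼y = x₁ , y₁ , ≼.trans _ [ x≺z ] z≼x₁ , m , y₁≼y
    precedence-to-next-process (msg i≢k m ∷ r) j≡1+i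
      with toℕ-injective (trans (message-level i≢k m) (sym j≡1+i))
    ... | refl = _ , _ , ε , m , [ precedence-within-process r ]

  message-squeeze :
    (P : Comms Pr) → IsDistributedSystem Pr P → CausalOrdering Pr P →
    ∀ {i j x y x₂ y₂} → i ≢ j → (x , y) ∈ P i j → (x₂ , y₂) ∈ P i j →
    ≼ i x x₂ → ≼ j y₂ y → x₂ ≡ x × y₂ ≡ y
  message-squeeze P dist _ i≢j m m₂ ε _ = refl , proj₂ (dist _ _ i≢j) m m₂
  message-squeeze P _ causal {i} {j} {y = y} {y₂ = y₂} i≢j m m₂ [ x≺x₂ ] y₂≼y =
    contradiction (≼.antisym j [ y≺y₂ ] y₂≼y) (proj₂ y≺y₂)
    where
    y≺y₂ : ≺ j y y₂
    y≺y₂ = causal i j i≢j _ _ _ _ m m₂ x≺x₂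

  messages-⊆ :
    (P P' : Comms Pr) → IsDistributedSystem Pr P → CausalOrdering Pr P →
    LineCommunication Pr P → LineCommunication Pr P' →
    CausalPrecedence Pr P ⇒ CausalPrecedence Pr P' → CausalPrecedence Pr P' ⇒ CausalPrecedence Pr P →
    ∀ i j → i ≢ j → ∀ x y → (x , y) ∈ P i j → (x , y) ∈ P' i j
  messages-⊆ P P' dist causal line line' to from i j i≢j x y m
    with precedence-to-next-process P' line' (to [ msg i≢j m ]) (message-level P line i≢j m)
  ... | x₁ , y₁ , x≼x₁ , m₁ , y₁≼y
    with precedence-to-next-process P line (from [ msg i≢j m₁ ]) (message-level P line i≢j m)
  ... | x₂ , y₂ , x₁≼x₂ , m₂ , y₂≼y₁
    with message-squeeze P dist causal i≢j m m₂ (≼.trans i x≼x₁ x₁≼x₂) (≼.trans j y₂≼y₁ y₁≼y)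
  ... | refl , refl = subst₂ (λ u v → (u , v) ∈ P' i j) x₁≡x y₁≡y m₁
    where
    x₁≡x : x₁ ≡ x
    x₁≡x = ≼.antisym i x₁≼x₂ x≼x₁
    y₁≡y : y₁ ≡ y
    y₁≡y = ≼.antisym j y₁≼y y₂≼y₁

  precedence-map : (P P' : Comms Pr) → SameComms Pr P P' → CausalPrecedence Pr P ⇒ CausalPrecedence Pr P'
  precedence-map P P' same = go
    where
    step : Step Pr P ⇒ Step Pr P'
    step (local x≺y)                 = local x≺y
    step (msg {i} {j} {x} {y} i≢j m) = msg i≢j (Equivalence.to (same i j i≢j x y) m)
    go : CausalPrecedence Pr P ⇒ CausalPrecedence Pr P'
    go [ s ]   = [ step s ]
    go (s ∷ r) = step s ∷ go r

  SameComms-sym : ∀ {P P'} → SameComms Pr P P' → SameComms Pr P' P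
  SameComms-sym same i j i≢j x y = mk⇔ (Equivalence.from (same i j i≢j x y)) (Equivalence.to (same i j i≢j x y))

proposition34 : ∀ {a ℓ : Level} (n : ℕ) (Pr : Processes n a ℓ) (P P' : Comms Pr) →
    IsDistributedSystem Pr P → IsDistributedSystem Pr P' →
    LineCommunication Pr P → LineCommunication Pr P' →
    CausalOrdering Pr P → CausalOrdering Pr P' →
    Acyclic Pr P → Acyclic Pr P' →
    SameRel Pr (CausalPrecedence Pr P) (CausalPrecedence Pr P') ⇔ SameComms Pr P P'
proposition34 n Pr P P' dist dist' line line' causal causal' _ _ = mk⇔ same-comms same-precedence
  where
  same-comms : SameRel Pr (CausalPrecedence Pr P) (CausalPrecedence Pr P') → SameComms Pr P P'
  same-comms same i j i≢j x y = mk⇔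
    (messages-⊆ Pr P P' dist causal line line' to from i j i≢j x y)
    (messages-⊆ Pr P' P dist' causal' line' line from to i j i≢j x y)
    where
    to : CausalPrecedence Pr P ⇒ CausalPrecedence Pr P'
    to = Equivalence.to (same _ _)
    from : CausalPrecedence Pr P' ⇒ CausalPrecedence Pr P
    from = Equivalence.from (same _ _)
  same-precedence : SameComms Pr P P' → SameRel Pr (CausalPrecedence Pr P) (CausalPrecedence Pr P')
  same-precedence same e e' = mk⇔ (precedence-map Pr P P' same) (precedence-map Pr P' P (SameComms-sym Pr same))
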